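{- Let $D=(V,E)$ be an $n$-vertex digraph and $k\in[n]$. Then \[A_D(t)=\sum_{S\subseteq V,\ |S|=k}\frac{t^{e_D(S,\overline S)}+t^{e_D(\overline S,S)}}{2}\,A_{D[S]}(t)\,A_{D-S}(t).\]
   Context: For an $n$-vertex digraph $D$ (no loops), a descent of a bijection $\sigma:V\to[n]$ is an arc $u\to v$ with $\sigma(u)>\sigma(v)$, $\mathrm{des}_D(\sigma)$ is the number of descents, and $A_D(t)=\sum_\sigma t^{\mathrm{des}_D(\sigma)}$ over all bijections; for the empty digraph $A=1$. $D[S]$ is the induced subdigraph on $S$, $D-S=D[V\setminus S]$, $\overline S=V\setminus S$, and $e_D(S,T)$ is the number of arcs $u\to v$ of $D$ with $u\in S$, $v\in T$. -}

module Defs where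

open import Data.Bool using (Bool; true; false; _∧_; if_then_else_)
open import Data.Nat using (ℕ; zero; suc; _*_; _∸_; _≡ᵇ_; _≤ᵇ_)
open import Data.Fin using (Fin; _<?_)
open import Data.Product using (_×_; _,_)
open import Data.List using (List; []; _∷_; [_]; map; concatMap; filterᵇ; length; upTo; allFin; _++_)
open import Data.Nat.ListAction using (sum)
open import Data.Bool.ListAction using (any; all)
open import Data.Vec using (Vec; lookup; fromList)
  renaming ([] to []ᵥ; _∷_ to _∷ᵥ_)
open import Data.Fin.Subset using (Subset; ∁)
open import Data.Fin.Properties using (_≟_)
open import Relation.Nullary.Decidable using (does)

-- A digraph on vertex set Fin m: D u v = true iff there is an arc u → v.
Digraph : ℕ → Set
Digraph m = Fin m → Fin m → Bool

-- All functions Fin k → Fin m, represented as vectors (σ(u) = lookup σ u).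
allVecs : (k m : ℕ) → List (Vec (Fin m) k)
allVecs zero    m = [ []ᵥ ]
allVecs (suc k) m = concatMap (λ i → map (i ∷ᵥ_) (allVecs k m)) (allFin m)

isBij : {m : ℕ} → Vec (Fin m) m → Bool
isBij {m} σ =
  all (λ u → all (λ v → if does (lookup σ u ≟ lookup σ v) then does (u ≟ v) else true) (allFin m)) (allFin m)
  ∧ all (λ y → any (λ x → does (lookup σ x ≟ y)) (allFin m)) (allFin m)

allPairs : (m : ℕ) → List (Fin m × Fin m)
allPairs m = concatMap (λ u → map (u ,_) (allFin m)) (allFin m)

countPairs : {m : ℕ} → (Fin m → Fin m → Bool) → ℕ
countPairs {m} P = length (filterᵇ (λ { (u , v) → P u v }) (allPairs m))

des : {m : ℕ} → Digraph m → Vec (Fin m) m → ℕ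
des D σ = countPairs (λ u v → D u v ∧ does (lookup σ v <? lookup σ u))

-- Polynomials in t with natural coefficients, as coefficient sequences:
-- f j = coefficient of t^j.
Poly : Set
Poly = ℕ → ℕ

-- A_D(t) = Σ_σ t^{des_D σ}, over all bijections σ : V → [m];
-- coefficient of t^j = number of bijections σ with des_D σ = j.
-- (For m = 0 this is the polynomial 1.)
A : {m : ℕ} → Digraph m → Poly
A {m} D j = length (filterᵇ (λ σ → isBij σ ∧ (des D σ ≡ᵇ j)) (allVecs m m))

_⋆_ : Poly → Poly → Poly
(f ⋆ g) j = sum (map (λ i → f i * g (j ∸ i)) (upTo (suc j)))

tpow*_ : ℕ → Poly → Poly
(tpow* a) f j = if a ≤ᵇ j then f (j ∸ a) else 0

_⊕_ : Poly → Poly → Poly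
(f ⊕ g) j = f j ℕ.+ g j
  where import Data.Nat as ℕ

allSubsets : (n : ℕ) → List (Subset n)
allSubsets zero    = [ []ᵥ ]
allSubsets (suc n) = map (true ∷ᵥ_) (allSubsets n) ++ map (false ∷ᵥ_) (allSubsets n)

elems : {n : ℕ} → Subset n → List (Fin n)
elems {n} S = filterᵇ (lookup S) (allFin n)

-- D[S]: the induced subdigraph on S, with vertex set S identified with
-- Fin |S| via the increasing enumeration of S.
induced : {n : ℕ} → Digraph n → (S : Subset n) → Digraph (length (elems S))
induced D S i j = D (lookup (fromList (elems S)) i) (lookup (fromList (elems S)) j)

delete : {n : ℕ} → Digraph n → (S : Subset n) → Digraph (length (elems (∁ S)))
delete D S = induced D (∁ S)

e : {n : ℕ} → Digraph n → Subset n → Subset n → ℕ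
e D S T = countPairs (λ u v → lookup S u ∧ lookup T v ∧ D u v)

-- A permutation σ of V splits uniquely into the set S of the k vertices it puts first together with
-- the orders α of S and β of V ∖ S in which σ lists them. The descents of σ are those of α in D[S],
-- those of β in D − S, and all e_D(V ∖ S, S) arcs from V ∖ S to S. Counting permutations through this
-- correspondence gives A_D = Σ_{|S| = k} t^{e_D(V∖S, S)} A_{D[S]} A_{D−S}. The same identity for n − k,
-- reindexed by S ↦ V ∖ S, is the companion sum with t^{e_D(S, V∖S)}; adding the two gives 2 A_D.
module Submission where

open import Data.Bool using (Bool; true; false; _∧_; not; T; if_then_else_)
open import Data.Bool.ListAction using (all; any)
open import Data.Bool.Properties using (T-≡; ∧-comm; ∧-identityʳ)
import Data.Bool.Properties as Bool
open import Data.Empty using (⊥-elim)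
open import Data.Fin using (Fin; zero; suc; toℕ; punchOut; fromℕ<; inject≤; cast; _↑ʳ_)
import Data.Fin.Properties as Fin
open import Data.Fin.Subset using (Subset; ∁; ∣_∣)
open import Data.Fin.Subset.Properties using (∪-∩-booleanAlgebra; ∣∁p∣≡n∸∣p∣; ∣p∣≤n)
open import Data.List using (List; []; _∷_; map; concatMap; filter; length; allFin; upTo; _++_)
import Data.List as List
open import Data.List.Membership.Propositional using (lose)
open import Data.List.Membership.Propositional.Properties using (∈-allFin; ∈-lookup; ∈-filter⁺; ∈-filter⁻)
open import Data.List.Properties using (map-cong; map-++; map-∘; map-tabulate; map-applyUpTo)
import Data.List.Relation.Unary.All as All
open import Data.List.Relation.Unary.All.Properties using (all⁺; all⁻; tabulate⁺; tabulate⁻)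
open import Data.List.Relation.Unary.AllPairs using () renaming (_∷_ to _∷ᴬ_)
import Data.List.Relation.Unary.Any as Any
open import Data.List.Relation.Unary.Any.Properties using (any⁺; any⁻; lookup-index)
open import Data.List.Relation.Unary.Unique.Propositional using (Unique)
import Data.List.Relation.Unary.Unique.Propositional.Properties as Unique
open import Data.Nat using (ℕ; zero; suc; _+_; _*_; _∸_; _≤_; _<_; _≡ᵇ_; _<ᵇ_; _≤ᵇ_; s≤s; z≤n)
open import Data.Nat.ListAction using (sum)
open import Data.Nat.ListAction.Properties using (sum-++)
open import Data.Nat.Properties
  using ( _≟_; _<?_; +-assoc; +-comm; +-identityʳ; +-cancelˡ-≡; *-comm; *-identityˡ; *-identityʳ; *-zeroʳ
        ; *-distribˡ-+; +-commutativeSemigroup; *-commutativeSemigroup; <-irrefl; <-≤-trans; <⇒≤; <⇒≢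
        ; <⇒≱; ≮⇒≥; m≤m+n; m+[n∸m]≡n; m+n∸m≡n; m∸[m∸n]≡n; m∸n≤m; ∸-monoˡ-<
        ; <ᵇ⇒<; <⇒<ᵇ; ≤ᵇ⇒≤; ≤⇒≤ᵇ; ≡ᵇ⇒≡; ≡⇒≡ᵇ)
open import Data.Product using (Σ; ∃; _×_; _,_; proj₁; proj₂)
import Data.Product.Properties as Product
open import Data.Sum using (_⊎_; inj₁; inj₂)
open import Data.Vec using (Vec; lookup; fromList; tabulate) renaming ([] to []ᵥ; _∷_ to _∷ᵥ_)
open import Data.Vec.Properties using (∷-injectiveˡ; ∷-injectiveʳ)
import Data.Vec.Properties as Vec
open import Function using (id; _∘_; _⇔_; mk⇔; Equivalence)
open import Function.Definitions using (Injective; StrictlySurjective)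
open import Level using (0ℓ)
open import Relation.Binary.Definitions using (DecidableEquality)
open import Relation.Binary.PropositionalEquality
  using (_≡_; _≢_; refl; sym; trans; cong; cong₂; subst; module ≡-Reasoning)
open import Relation.Nullary using (¬_; Dec; yes; no; does; contradiction)
open import Relation.Nullary.Decidable using (T?)
open import Relation.Unary using (Pred; Decidable)
open import Algebra.Properties.CommutativeSemigroup +-commutativeSemigroup
  using () renaming (interchange to +-interchange)
open import Algebra.Properties.CommutativeSemigroup *-commutativeSemigroup
  using () renaming (interchange to *-interchange)
open import Defs
open ≡-Reasoning

⟦_⟧ : Bool → ℕ
⟦ true ⟧ = 1
⟦ false ⟧ = 0

⟦∧⟧ : ∀ a b → ⟦ a ∧ b ⟧ ≡ ⟦ a ⟧ * ⟦ b ⟧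
⟦∧⟧ true b = sym (*-identityˡ ⟦ b ⟧)
⟦∧⟧ false b = refl

T-∧⁺ : ∀ {a b} → T a → T b → T (a ∧ b)
T-∧⁺ {true} _ tb = tb

T-∧⁻ : ∀ a {b} → T (a ∧ b) → T a × T b
T-∧⁻ true tb = _ , tb

¬T⇒≡false : ∀ {b} → ¬ T b → b ≡ false
¬T⇒≡false {true} ¬b = contradiction _ ¬b
¬T⇒≡false {false} _ = refl

⟦⟧-false : ∀ {b} → ¬ T b → ⟦ b ⟧ ≡ 0
⟦⟧-false = cong ⟦_⟧ ∘ ¬T⇒≡false

T-not : ∀ {b} → T (not b) ⇔ (¬ T b)
T-not {true} = mk⇔ (λ ()) (λ ¬b → ¬b _)
T-not {false} = mk⇔ (λ _ ()) (λ _ → _)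

T-injective : ∀ {a b} → (T a → T b) → (T b → T a) → a ≡ b
T-injective {true} {true} _ _ = refl
T-injective {true} {false} a⇒b _ = ⊥-elim (a⇒b _)
T-injective {false} {true} _ b⇒a = ⊥-elim (b⇒a _)
T-injective {false} {false} _ _ = refl

T-does : {P : Set} (P? : Dec P) → T (does P?) ⇔ P
T-does (yes p) = mk⇔ (λ _ → p) (λ _ → _)
T-does (no ¬p) = mk⇔ (λ ()) ¬p

T-if-does : {P Q : Set} (P? : Dec P) (Q? : Dec Q) → T (if does P? then does Q? else true) ⇔ (P → Q)
T-if-does (yes p) Q? = mk⇔ (λ q _ → Equivalence.to (T-does Q?) q) (λ p⇒q → Equivalence.from (T-does Q?) (p⇒q p))
T-if-does (no ¬p) Q? = mk⇔ (λ _ p → contradiction p ¬p) (λ _ → _)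

-- Finite sums

∑ : {X : Set} → List X → (X → ℕ) → ℕ
∑ xs f = sum (map f xs)

module _ {X : Set} where

  ∑-cong : ∀ xs {f g : X → ℕ} → (∀ x → f x ≡ g x) → ∑ xs f ≡ ∑ xs g
  ∑-cong xs f≗g = cong sum (map-cong f≗g xs)

  ∑-++ : ∀ xs ys (f : X → ℕ) → ∑ (xs ++ ys) f ≡ ∑ xs f + ∑ ys f
  ∑-++ xs ys f = trans (cong sum (map-++ f xs ys)) (sum-++ (map f xs) (map f ys))

  ∑-+ : ∀ xs (f g : X → ℕ) → ∑ xs (λ x → f x + g x) ≡ ∑ xs f + ∑ xs g
  ∑-+ [] f g = refl
  ∑-+ (x ∷ xs) f g = trans (cong (f x + g x +_) (∑-+ xs f g)) (+-interchange (f x) (g x) _ _)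

  ∑-*ˡ : ∀ xs c (f : X → ℕ) → ∑ xs (λ x → c * f x) ≡ c * ∑ xs f
  ∑-*ˡ [] c f = sym (*-zeroʳ c)
  ∑-*ˡ (x ∷ xs) c f = trans (cong (c * f x +_) (∑-*ˡ xs c f)) (sym (*-distribˡ-+ c (f x) _))

  ∑-*ʳ : ∀ xs c (f : X → ℕ) → ∑ xs (λ x → f x * c) ≡ ∑ xs f * c
  ∑-*ʳ xs c f = trans (∑-cong xs (λ x → *-comm (f x) c)) (trans (∑-*ˡ xs c f) (*-comm c (∑ xs f)))

  ∑-zero : ∀ xs {f : X → ℕ} → (∀ x → f x ≡ 0) → ∑ xs f ≡ 0
  ∑-zero [] f≗0 = refl
  ∑-zero (x ∷ xs) f≗0 = cong₂ _+_ (f≗0 x) (∑-zero xs f≗0)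

  length-filter : {P : Pred X 0ℓ} (P? : Decidable P) (xs : List X) →
                  length (filter P? xs) ≡ ∑ xs (λ x → ⟦ does (P? x) ⟧)
  length-filter P? [] = refl
  length-filter P? (x ∷ xs) with does (P? x)
  ... | true = cong suc (length-filter P? xs)
  ... | false = length-filter P? xs

  ∑-filter : {P : Pred X 0ℓ} (P? : Decidable P) (xs : List X) (f : X → ℕ) →
             ∑ (filter P? xs) f ≡ ∑ xs (λ x → ⟦ does (P? x) ⟧ * f x)
  ∑-filter P? [] f = refl
  ∑-filter P? (x ∷ xs) f with does (P? x)
  ... | true = cong₂ _+_ (sym (*-identityˡ (f x))) (∑-filter P? xs f)
  ... | false = ∑-filter P? xs f

module _ {X Y : Set} where

  ∑-map : ∀ (h : X → Y) xs (f : Y → ℕ) → ∑ (map h xs) f ≡ ∑ xs (f ∘ h)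
  ∑-map h xs f = cong sum (sym (map-∘ xs))

  ∑-concatMap : ∀ (h : X → List Y) xs (f : Y → ℕ) → ∑ (concatMap h xs) f ≡ ∑ xs (λ x → ∑ (h x) f)
  ∑-concatMap h [] f = refl
  ∑-concatMap h (x ∷ xs) f =
    trans (∑-++ (h x) (concatMap h xs) f) (cong (∑ (h x) f +_) (∑-concatMap h xs f))

  ∑-swap : ∀ xs ys (f : X → Y → ℕ) → ∑ xs (λ x → ∑ ys (f x)) ≡ ∑ ys (λ y → ∑ xs (λ x → f x y))
  ∑-swap [] ys f = sym (∑-zero ys (λ _ → refl))
  ∑-swap (x ∷ xs) ys f = trans (cong (∑ ys (f x) +_) (∑-swap xs ys f)) (sym (∑-+ ys (f x) _))

  ∑-product : ∀ xs ys (f : X → ℕ) (g : Y → ℕ) →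
              ∑ xs f * ∑ ys g ≡ ∑ xs (λ x → ∑ ys (λ y → f x * g y))
  ∑-product xs ys f g = trans (sym (∑-*ʳ xs (∑ ys g) f)) (∑-cong xs (λ x → sym (∑-*ˡ ys (f x) g)))

∑-allFin-suc : ∀ {n} (f : Fin (suc n) → ℕ) → ∑ (allFin (suc n)) f ≡ f zero + ∑ (allFin n) (f ∘ suc)
∑-allFin-suc f =
  cong (λ xs → f zero + sum xs) (trans (map-tabulate suc f) (sym (map-tabulate id (f ∘ suc))))

∑-upTo-suc : ∀ N (g : ℕ → ℕ) → ∑ (upTo (suc N)) g ≡ g 0 + ∑ (upTo N) (g ∘ suc)
∑-upTo-suc N g =
  cong (λ xs → g 0 + sum xs) (trans (map-applyUpTo suc g N) (sym (map-applyUpTo id (g ∘ suc) N)))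

-- Enumerations

-- xs lists every element of X exactly once
record Enumerates {X : Set} (xs : List X) : Set where
  field
    ∑-select : ∀ x₀ (g : X → ℕ) → (∀ x → x ≢ x₀ → g x ≡ 0) → ∑ xs g ≡ g x₀
open Enumerates

_⊗_ : {A : Set} {B : A → Set} → List A → ((a : A) → List (B a)) → List (Σ A B)
as ⊗ bs = concatMap (λ a → map (a ,_) (bs a)) as

∑-⊗ : {A : Set} {B : A → Set} (as : List A) (bs : (a : A) → List (B a)) (f : Σ A B → ℕ) →
      ∑ (as ⊗ bs) f ≡ ∑ as (λ a → ∑ (bs a) (λ b → f (a , b)))
∑-⊗ as bs f = trans (∑-concatMap _ as f) (∑-cong as (λ a → ∑-map (a ,_) (bs a) f))

⊗-enumerates : {A : Set} {B : A → Set} {as : List A} {bs : (a : A) → List (B a)} →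
               Enumerates as → (∀ a → Enumerates (bs a)) → Enumerates (as ⊗ bs)
⊗-enumerates {as = as} {bs} as-enum bs-enum .∑-select (a₀ , b₀) g g₀ = begin
  ∑ (as ⊗ bs) g                           ≡⟨ ∑-⊗ as bs g ⟩
  ∑ as (λ a → ∑ (bs a) (λ b → g (a , b))) ≡⟨ ∑-select as-enum a₀ _ off-a₀ ⟩
  ∑ (bs a₀) (λ b → g (a₀ , b))            ≡⟨ ∑-select (bs-enum a₀) b₀ _ off-b₀ ⟩
  g (a₀ , b₀)                             ∎
  where
  off-a₀ : ∀ a → a ≢ a₀ → ∑ (bs a) (λ b → g (a , b)) ≡ 0
  off-a₀ a a≢a₀ = ∑-zero (bs a) (λ b → g₀ _ (λ { refl → a≢a₀ refl }))
  off-b₀ : ∀ b → b ≢ b₀ → g (a₀ , b) ≡ 0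
  off-b₀ b b≢b₀ = g₀ _ (λ { refl → b≢b₀ refl })

allFin-enumerates : ∀ n → Enumerates (allFin n)
allFin-enumerates (suc n) .∑-select zero g g₀ = begin
  ∑ (allFin (suc n)) g            ≡⟨ ∑-allFin-suc g ⟩
  g zero + ∑ (allFin n) (g ∘ suc) ≡⟨ cong (g zero +_) (∑-zero (allFin n) (λ i → g₀ (suc i) λ ())) ⟩
  g zero + 0                      ≡⟨ +-identityʳ (g zero) ⟩
  g zero                          ∎
allFin-enumerates (suc n) .∑-select (suc i₀) g g₀ = begin
  ∑ (allFin (suc n)) g            ≡⟨ ∑-allFin-suc g ⟩
  g zero + ∑ (allFin n) (g ∘ suc) ≡⟨ cong (_+ ∑ (allFin n) (g ∘ suc)) (g₀ zero λ ()) ⟩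
  ∑ (allFin n) (g ∘ suc)          ≡⟨ ∑-select (allFin-enumerates n) i₀ (g ∘ suc) off-i₀ ⟩
  g (suc i₀)                      ∎
  where
  off-i₀ : ∀ i → i ≢ i₀ → g (suc i) ≡ 0
  off-i₀ i i≢i₀ = g₀ (suc i) (i≢i₀ ∘ Fin.suc-injective)

allVecs-enumerates : ∀ k m → Enumerates (allVecs k m)
allVecs-enumerates zero m .∑-select []ᵥ g _ = +-identityʳ (g []ᵥ)
allVecs-enumerates (suc k) m .∑-select (i₀ ∷ᵥ τ₀) g g₀ = begin
  ∑ (allVecs (suc k) m) g
    ≡⟨ ∑-concatMap _ (allFin m) g ⟩
  ∑ (allFin m) (λ i → ∑ (map (i ∷ᵥ_) (allVecs k m)) g)
    ≡⟨ ∑-cong (allFin m) (λ i → ∑-map (i ∷ᵥ_) (allVecs k m) g) ⟩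
  ∑ (allFin m) (λ i → ∑ (allVecs k m) (λ τ → g (i ∷ᵥ τ)))
    ≡⟨ ∑-select (allFin-enumerates m) i₀ _ off-i₀ ⟩
  ∑ (allVecs k m) (λ τ → g (i₀ ∷ᵥ τ))
    ≡⟨ ∑-select (allVecs-enumerates k m) τ₀ _ off-τ₀ ⟩
  g (i₀ ∷ᵥ τ₀) ∎
  where
  off-i₀ : ∀ i → i ≢ i₀ → ∑ (allVecs k m) (λ τ → g (i ∷ᵥ τ)) ≡ 0
  off-i₀ i i≢i₀ = ∑-zero (allVecs k m) (λ τ → g₀ _ (i≢i₀ ∘ ∷-injectiveˡ))
  off-τ₀ : ∀ τ → τ ≢ τ₀ → g (i₀ ∷ᵥ τ) ≡ 0
  off-τ₀ τ τ≢τ₀ = g₀ _ (τ≢τ₀ ∘ ∷-injectiveʳ)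

allSubsets-enumerates : ∀ n → Enumerates (allSubsets n)
allSubsets-enumerates zero .∑-select []ᵥ g _ = +-identityʳ (g []ᵥ)
allSubsets-enumerates (suc n) .∑-select (b₀ ∷ᵥ S₀) g g₀ = begin
  ∑ (allSubsets (suc n)) g
    ≡⟨ ∑-++ (map (true ∷ᵥ_) L) (map (false ∷ᵥ_) L) g ⟩
  ∑ (map (true ∷ᵥ_) L) g + ∑ (map (false ∷ᵥ_) L) g
    ≡⟨ cong₂ _+_ (∑-map (true ∷ᵥ_) L g) (∑-map (false ∷ᵥ_) L g) ⟩
  ∑ L (g ∘ (true ∷ᵥ_)) + ∑ L (g ∘ (false ∷ᵥ_))
    ≡⟨ pick b₀ g₀ ⟩
  g (b₀ ∷ᵥ S₀) ∎
  where
  L = allSubsets n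
  select : ∀ b → (∀ S → S ≢ b ∷ᵥ S₀ → g S ≡ 0) → ∑ L (g ∘ (b ∷ᵥ_)) ≡ g (b ∷ᵥ S₀)
  select b supp = ∑-select (allSubsets-enumerates n) S₀ _ (λ S S≢S₀ → supp _ (S≢S₀ ∘ ∷-injectiveʳ))
  pick : ∀ b → (∀ S → S ≢ b ∷ᵥ S₀ → g S ≡ 0) →
         ∑ L (g ∘ (true ∷ᵥ_)) + ∑ L (g ∘ (false ∷ᵥ_)) ≡ g (b ∷ᵥ S₀)
  pick true supp = trans (cong₂ _+_ (select true supp) (∑-zero L (λ S → supp _ (λ ())))) (+-identityʳ _)
  pick false supp = cong₂ _+_ (∑-zero L (λ S → supp _ (λ ()))) (select false supp)

module _ {X Y : Set} {xs : List X} {ys : List Y} (_≟ʸ_ : DecidableEquality Y)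
         (xs-enum : Enumerates xs) (ys-enum : Enumerates ys)
         (f : X → Y) (g : Y → X) (p : X → Bool) (q : Y → Bool)
         (forth : ∀ x → T (p x) → T (q (f x)) × g (f x) ≡ x)
         (back : ∀ y → T (q y) → T (p (g y)) × f (g y) ≡ y) where

  -- Both sides are the total weight of the graph {(x , f x) | p x}, summed from either end.
  ∑-bijection : ∀ (h : Y → ℕ) → ∑ xs (λ x → ⟦ p x ⟧ * h (f x)) ≡ ∑ ys (λ y → ⟦ q y ⟧ * h y)
  ∑-bijection h = begin
    ∑ xs (λ x → ⟦ p x ⟧ * h (f x))      ≡⟨ ∑-cong xs (λ x → sym (trans (∑-select ys-enum (f x) _ (off-graph x))
                                                                        (on-graph x))) ⟩
    ∑ xs (λ x → ∑ ys (graph x))         ≡⟨ ∑-swap xs ys graph ⟩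
    ∑ ys (λ y → ∑ xs (λ x → graph x y)) ≡⟨ ∑-cong ys (λ y → ∑-select xs-enum (g y) _ (off-inverse y)) ⟩
    ∑ ys (λ y → graph (g y) y)          ≡⟨ ∑-cong ys on-inverse ⟩
    ∑ ys (λ y → ⟦ q y ⟧ * h y)          ∎
    where
    graph : X → Y → ℕ
    graph x y with y ≟ʸ f x
    ... | yes _ = ⟦ p x ⟧ * h y
    ... | no _ = 0

    off-graph : ∀ x y → y ≢ f x → graph x y ≡ 0
    off-graph x y y≢fx with y ≟ʸ f x
    ... | yes y≡fx = contradiction y≡fx y≢fx
    ... | no _ = refl

    on-graph : ∀ x → graph x (f x) ≡ ⟦ p x ⟧ * h (f x)
    on-graph x with f x ≟ʸ f x
    ... | yes _ = refl
    ... | no fx≢fx = contradiction refl fx≢fx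

    off-inverse : ∀ y x → x ≢ g y → graph x y ≡ 0
    off-inverse y x x≢gy with y ≟ʸ f x
    ... | no _ = refl
    ... | yes refl = cong (_* h (f x)) (⟦⟧-false (λ px → x≢gy (sym (proj₂ (forth x px)))))

    on-inverse : ∀ y → graph (g y) y ≡ ⟦ q y ⟧ * h y
    on-inverse y with y ≟ʸ f (g y)
    ... | yes y≡fgy = cong (λ b → ⟦ b ⟧ * h y) (T-injective
          (λ pgy → subst (T ∘ q) (sym y≡fgy) (proj₁ (forth (g y) pgy))) (proj₁ ∘ back y))
    ... | no y≢fgy = sym (cong (_* h y) (⟦⟧-false (λ qy → y≢fgy (sym (proj₂ (back y qy))))))

module _ {X Y : Set} {xs : List X} {ys : List Y} (_≟ʸ_ : DecidableEquality Y)
         (xs-enum : Enumerates xs) (ys-enum : Enumerates ys)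
         (f : X → Y) (g : Y → X) (g∘f≗id : ∀ x → g (f x) ≡ x) (f∘g≗id : ∀ y → f (g y) ≡ y) where

  ∑-reindex : ∀ (h : Y → ℕ) → ∑ xs (h ∘ f) ≡ ∑ ys h
  ∑-reindex h = begin
    ∑ xs (h ∘ f)              ≡⟨ ∑-cong xs (λ x → sym (*-identityˡ (h (f x)))) ⟩
    ∑ xs (λ x → 1 * h (f x))  ≡⟨ ∑-bijection _≟ʸ_ xs-enum ys-enum f g _ _ (λ x _ → _ , g∘f≗id x)
                                                                          (λ y _ → _ , f∘g≗id y) h ⟩
    ∑ ys (λ y → 1 * h y)      ≡⟨ ∑-cong ys (λ y → *-identityˡ (h y)) ⟩
    ∑ ys h                    ∎

∁-involutive : ∀ {n} (S : Subset n) → ∁ (∁ S) ≡ S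
∁-involutive {n} = ¬-involutive
  where open import Algebra.Lattice.Properties.BooleanAlgebra (∪-∩-booleanAlgebra n) using (¬-involutive)

∑-allSubsets-∁ : ∀ {n} (h : Subset n → ℕ) → ∑ (allSubsets n) (h ∘ ∁) ≡ ∑ (allSubsets n) h
∑-allSubsets-∁ {n} = ∑-reindex (Vec.≡-dec Bool._≟_) enum enum ∁ ∁ ∁-involutive ∁-involutive
  where enum = allSubsets-enumerates n

-- Permutations

all-allFin : ∀ {n} (p : Fin n → Bool) → T (all p (allFin n)) ⇔ (∀ i → T (p i))
all-allFin {n} p = mk⇔ (tabulate⁻ ∘ all⁺ p (allFin n)) (λ pᵢ → all⁻ p (tabulate⁺ pᵢ))

any-allFin : ∀ {n} (p : Fin n → Bool) → T (any p (allFin n)) ⇔ ∃ (T ∘ p)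
any-allFin {n} p = mk⇔ (Any.satisfied ∘ any⁻ p (allFin n)) (λ (i , pᵢ) → any⁺ p (lose (∈-allFin i) pᵢ))

-- An injection missing some y would inject Fin (suc n) into Fin n after punching out y.
injective⇒surjective : ∀ {n} {f : Fin n → Fin n} → Injective _≡_ _≡_ f → StrictlySurjective _≡_ f
injective⇒surjective {suc n} {f} f-inj y with Fin.any? (λ x → f x Fin.≟ y)
... | yes hit = hit
... | no miss = contradiction (Fin.injective⇒≤ punched-injective) (<-irrefl refl)
  where
  punched : Fin (suc n) → Fin n
  punched x = punchOut {i = y} (λ y≡fx → miss (x , sym y≡fx))
  punched-injective : Injective _≡_ _≡_ punched
  punched-injective = f-inj ∘ Fin.punchOut-injective {i = y} _ _

isBij⇔injective : ∀ {m} (σ : Vec (Fin m) m) → T (isBij σ) ⇔ Injective _≡_ _≡_ (lookup σ)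
isBij⇔injective {m} σ = mk⇔ sound complete
  where
  injectivity : ∀ u v → T (if does (lookup σ u Fin.≟ lookup σ v) then does (u Fin.≟ v) else true)
                      ⇔ (lookup σ u ≡ lookup σ v → u ≡ v)
  injectivity u v = T-if-does (lookup σ u Fin.≟ lookup σ v) (u Fin.≟ v)

  sound : T (isBij σ) → Injective _≡_ _≡_ (lookup σ)
  sound bij {u} {v} = Equivalence.to (injectivity u v)
    (Equivalence.to (all-allFin _) (Equivalence.to (all-allFin _) (proj₁ (T-∧⁻ _ bij)) u) v)

  complete : Injective _≡_ _≡_ (lookup σ) → T (isBij σ)
  complete σ-inj = T-∧⁺ injective surjective
    where
    injective = Equivalence.from (all-allFin _) λ u →
                  Equivalence.from (all-allFin _) λ v → Equivalence.from (injectivity u v) σ-inj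
    surjective = Equivalence.from (all-allFin _) λ y →
                   let (x , σx≡y) = injective⇒surjective σ-inj y
                   in Equivalence.from (any-allFin _) (x , Equivalence.from (T-does (lookup σ x Fin.≟ y)) σx≡y)

∑-permute : ∀ {n} (σ : Vec (Fin n) n) → Injective _≡_ _≡_ (lookup σ) →
            ∀ (h : Fin n → ℕ) → ∑ (allFin n) (h ∘ lookup σ) ≡ ∑ (allFin n) h
∑-permute {n} σ σ-inj =
  ∑-reindex Fin._≟_ (allFin-enumerates n) (allFin-enumerates n) (lookup σ) σ⁻¹
            (λ v → σ-inj (proj₂ (σ-onto (lookup σ v)))) (proj₂ ∘ σ-onto)
  where
  σ-onto = injective⇒surjective σ-inj
  σ⁻¹ = proj₁ ∘ σ-onto

pos : ∀ {k l} → Vec (Fin k) l → Fin l → ℕ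
pos σ v = toℕ (lookup σ v)

tabulate-≡ : ∀ {A : Set} {n} {f : Fin n → A} {xs : Vec A n} → (∀ i → f i ≡ lookup xs i) → tabulate f ≡ xs
tabulate-≡ {xs = xs} f≗xs = trans (Vec.tabulate-cong f≗xs) (Vec.tabulate∘lookup xs)

≗pos⇒≡ : ∀ {k l} {σ τ : Vec (Fin k) l} → (∀ v → pos σ v ≡ pos τ v) → σ ≡ τ
≗pos⇒≡ {σ = σ} eq = trans (sym (Vec.tabulate∘lookup σ)) (tabulate-≡ (Fin.toℕ-injective ∘ eq))

-- x as an element of Fin k, with the junk value d when x ≥ k
fromℕ-or : ∀ {k} → ℕ → Fin k → Fin k
fromℕ-or {k} x d with x <? k
... | yes x<k = fromℕ< x<k
... | no _ = d

toℕ-fromℕ-or : ∀ {k} x (d : Fin k) → x < k → toℕ (fromℕ-or x d) ≡ x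
toℕ-fromℕ-or {k} x d x<k with x <? k
... | yes x<k = Fin.toℕ-fromℕ< x<k
... | no x≮k = contradiction x<k x≮k

+-<ᵇ : ∀ m a b → (m + a <ᵇ m + b) ≡ (a <ᵇ b)
+-<ᵇ zero a b = refl
+-<ᵇ (suc m) a b = +-<ᵇ m a b

∑-allFin-<ᵇ : ∀ {n k} → k ≤ n → ∑ (allFin n) (λ y → ⟦ toℕ y <ᵇ k ⟧) ≡ k
∑-allFin-<ᵇ {n} {zero} _ = ∑-zero (allFin n) (λ _ → refl)
∑-allFin-<ᵇ {suc n} {suc k} (s≤s k≤n) =
  trans (∑-allFin-suc {n} (λ y → ⟦ toℕ y <ᵇ suc k ⟧)) (cong suc (∑-allFin-<ᵇ k≤n))

∣S∣≡∑ : ∀ {n} (S : Subset n) → ∣ S ∣ ≡ ∑ (allFin n) (λ v → ⟦ lookup S v ⟧)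
∣S∣≡∑ []ᵥ = refl
∣S∣≡∑ {suc n} (b ∷ᵥ S) = trans (head b) (sym (∑-allFin-suc (λ v → ⟦ lookup (b ∷ᵥ S) v ⟧)))
  where
  head : ∀ b → ∣ b ∷ᵥ S ∣ ≡ ⟦ b ⟧ + ∑ (allFin n) (λ v → ⟦ lookup S v ⟧)
  head true = cong suc (∣S∣≡∑ S)
  head false = ∣S∣≡∑ S

lowerSet : ∀ {n} → ℕ → Vec (Fin n) n → Subset n
lowerSet k σ = tabulate (λ v → pos σ v <ᵇ k)

∣lowerSet∣ : ∀ {n k} (σ : Vec (Fin n) n) → Injective _≡_ _≡_ (lookup σ) → k ≤ n → ∣ lowerSet k σ ∣ ≡ k
∣lowerSet∣ {n} {k} σ σ-inj k≤n = begin
  ∣ lowerSet k σ ∣                                  ≡⟨ ∣S∣≡∑ (lowerSet k σ) ⟩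
  ∑ (allFin n) (λ v → ⟦ lookup (lowerSet k σ) v ⟧)  ≡⟨ ∑-cong (allFin n) (cong ⟦_⟧ ∘ Vec.lookup∘tabulate _) ⟩
  ∑ (allFin n) (λ v → ⟦ pos σ v <ᵇ k ⟧)             ≡⟨ ∑-permute σ σ-inj (λ y → ⟦ toℕ y <ᵇ k ⟧) ⟩
  ∑ (allFin n) (λ y → ⟦ toℕ y <ᵇ k ⟧)               ≡⟨ ∑-allFin-<ᵇ k≤n ⟩
  k                                                 ∎

descent : ∀ {k} → Digraph k → Vec (Fin k) k → Fin k → Fin k → ℕ
descent X σ u v = ⟦ X u v ∧ (pos σ v <ᵇ pos σ u) ⟧

blockSum : ∀ {n k l} → (Fin n → Fin n → ℕ) → (Fin k → Fin n) → (Fin l → Fin n) → ℕ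
blockSum {k = k} {l} F a b = ∑ (allFin k) (λ i → ∑ (allFin l) (λ j → F (a i) (b j)))

countPairs-∑ : ∀ {n} (P : Fin n → Fin n → Bool) → countPairs P ≡ blockSum (λ u v → ⟦ P u v ⟧) id id
countPairs-∑ {n} P =
  trans (length-filter (T? ∘ λ { (u , v) → P u v }) (allPairs n)) (∑-⊗ (allFin n) (λ _ → allFin n) _)

des-blockSum : ∀ {k} (X : Digraph k) σ → des X σ ≡ blockSum (descent X σ) id id
des-blockSum X σ = countPairs-∑ (λ u v → X u v ∧ does (lookup σ v Fin.<? lookup σ u))

lookup-fromList : {X : Set} (xs : List X) (i : Fin (length xs)) → lookup (fromList xs) i ≡ List.lookup xs i
lookup-fromList (x ∷ xs) zero = refl
lookup-fromList (x ∷ xs) (suc i) = lookup-fromList xs i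

∑-fromList : {X : Set} (xs : List X) (f : X → ℕ) → ∑ xs f ≡ ∑ (allFin (length xs)) (f ∘ lookup (fromList xs))
∑-fromList [] f = refl
∑-fromList (x ∷ xs) f =
  trans (cong (f x +_) (∑-fromList xs f)) (sym (∑-allFin-suc (f ∘ lookup (fromList (x ∷ xs)))))

lookup-injective : {X : Set} {xs : List X} → Unique xs → Injective _≡_ _≡_ (List.lookup xs)
lookup-injective (x∉xs ∷ᴬ xs!) {zero} {zero} _ = refl
lookup-injective (x∉xs ∷ᴬ xs!) {zero} {suc j} eq = contradiction eq (All.lookup x∉xs (∈-lookup j))
lookup-injective (x∉xs ∷ᴬ xs!) {suc i} {zero} eq = contradiction (sym eq) (All.lookup x∉xs (∈-lookup i))
lookup-injective (x∉xs ∷ᴬ xs!) {suc i} {suc j} eq = cong suc (lookup-injective xs! eq)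

-- The vertices of S in increasing order: this is how induced identifies D[S] with a digraph on Fin size.
module Members {n : ℕ} (S : Subset n) where

  size : ℕ
  size = length (elems S)

  member : Fin size → Fin n
  member = lookup (fromList (elems S))

  member-∈ : ∀ i → T (lookup S (member i))
  member-∈ i = subst (T ∘ lookup S) (sym (lookup-fromList (elems S) i))
                 (proj₂ (∈-filter⁻ (T? ∘ lookup S) {xs = allFin n} (∈-lookup i)))

  member-injective : Injective _≡_ _≡_ member
  member-injective {i} {j} eq = lookup-injective (Unique.filter⁺ (T? ∘ lookup S) (Unique.allFin⁺ n))
    (trans (sym (lookup-fromList (elems S) i)) (trans eq (lookup-fromList (elems S) j)))

  rank : ∀ v → T (lookup S v) → Fin size
  rank v v∈S = Any.index (∈-filter⁺ (T? ∘ lookup S) (∈-allFin v) v∈S)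

  member-rank : ∀ v v∈S → member (rank v v∈S) ≡ v
  member-rank v v∈S =
    trans (lookup-fromList (elems S) _) (sym (lookup-index (∈-filter⁺ (T? ∘ lookup S) (∈-allFin v) v∈S)))

  rank-member : ∀ i i∈S → rank (member i) i∈S ≡ i
  rank-member i i∈S = member-injective (member-rank (member i) i∈S)

  ∑-members : ∀ (f : Fin n → ℕ) → ∑ (allFin n) (λ v → ⟦ lookup S v ⟧ * f v) ≡ ∑ (allFin size) (f ∘ member)
  ∑-members f = trans (sym (∑-filter (T? ∘ lookup S) (allFin n) f)) (∑-fromList (elems S) f)

  size≡∣S∣ : size ≡ ∣ S ∣
  size≡∣S∣ = trans (length-filter (T? ∘ lookup S) (allFin n)) (sym (∣S∣≡∑ S))

⟦b⟧*x+⟦¬b⟧*x : ∀ b x → ⟦ b ⟧ * x + ⟦ not b ⟧ * x ≡ x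
⟦b⟧*x+⟦¬b⟧*x true x = trans (+-identityʳ (1 * x)) (*-identityˡ x)
⟦b⟧*x+⟦¬b⟧*x false x = *-identityˡ x

-- Splitting a permutation along a subset

module Split {n : ℕ} (S : Subset n) where

  module In = Members S
  module Out = Members (∁ S)

  m m' : ℕ
  m = In.size
  m' = Out.size

  lookup-∁ : ∀ v → lookup (∁ S) v ≡ not (lookup S v)
  lookup-∁ v = Vec.lookup-map v not S

  ∈∁⇔∉ : ∀ v → T (lookup (∁ S) v) ⇔ (¬ T (lookup S v))
  ∈∁⇔∉ v = subst (λ b → T b ⇔ (¬ T (lookup S v))) (sym (lookup-∁ v)) T-not

  Out-member-∉ : ∀ i → ¬ T (lookup S (Out.member i))
  Out-member-∉ i = Equivalence.to (∈∁⇔∉ (Out.member i)) (Out.member-∈ i)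

  member-cases : ∀ v → (∃ λ i → In.member i ≡ v) ⊎ (∃ λ i → Out.member i ≡ v)
  member-cases v with T? (lookup S v)
  ... | yes v∈S = inj₁ (In.rank v v∈S , In.member-rank v v∈S)
  ... | no v∉S = inj₂ (Out.rank v v∈∁S , Out.member-rank v v∈∁S)
    where v∈∁S = Equivalence.from (∈∁⇔∉ v) v∉S

  m+m'≡n : m + m' ≡ n
  m+m'≡n = trans (cong₂ _+_ In.size≡∣S∣ (trans Out.size≡∣S∣ (∣∁p∣≡n∸∣p∣ S))) (m+[n∸m]≡n (∣p∣≤n S))

  m≤n : m ≤ n
  m≤n = subst (m ≤_) m+m'≡n (m≤m+n m m')

  ∑-split : ∀ (f : Fin n → ℕ) → ∑ (allFin n) f ≡ ∑ (allFin m) (f ∘ In.member) + ∑ (allFin m') (f ∘ Out.member)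
  ∑-split f = begin
    ∑ (allFin n) f
      ≡⟨ ∑-cong (allFin n) (λ v → sym (partition v)) ⟩
    ∑ (allFin n) (λ v → ⟦ lookup S v ⟧ * f v + ⟦ lookup (∁ S) v ⟧ * f v)
      ≡⟨ ∑-+ (allFin n) _ _ ⟩
    ∑ (allFin n) (λ v → ⟦ lookup S v ⟧ * f v) + ∑ (allFin n) (λ v → ⟦ lookup (∁ S) v ⟧ * f v)
      ≡⟨ cong₂ _+_ (In.∑-members f) (Out.∑-members f) ⟩
    ∑ (allFin m) (f ∘ In.member) + ∑ (allFin m') (f ∘ Out.member) ∎
    where
    partition : ∀ v → ⟦ lookup S v ⟧ * f v + ⟦ lookup (∁ S) v ⟧ * f v ≡ f v
    partition v = trans (cong (λ b → ⟦ lookup S v ⟧ * f v + ⟦ b ⟧ * f v) (lookup-∁ v))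
                        (⟦b⟧*x+⟦¬b⟧*x (lookup S v) (f v))

  blockSum-split : ∀ (F : Fin n → Fin n → ℕ) →
    blockSum F id id ≡ (blockSum F In.member In.member + blockSum F In.member Out.member)
                     + (blockSum F Out.member In.member + blockSum F Out.member Out.member)
  blockSum-split F = begin
    blockSum F id id
      ≡⟨ ∑-split (λ u → ∑ (allFin n) (F u)) ⟩
    ∑ (allFin m) (λ i → ∑ (allFin n) (F (In.member i))) + ∑ (allFin m') (λ i → ∑ (allFin n) (F (Out.member i)))
      ≡⟨ cong₂ _+_ (trans (∑-cong (allFin m) (λ i → ∑-split (F (In.member i)))) (∑-+ (allFin m) _ _))
                   (trans (∑-cong (allFin m') (λ i → ∑-split (F (Out.member i)))) (∑-+ (allFin m') _ _)) ⟩
    (blockSum F In.member In.member + blockSum F In.member Out.member)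
      + (blockSum F Out.member In.member + blockSum F Out.member Out.member) ∎

  e-∁S-S : ∀ (D : Digraph n) → e D (∁ S) S ≡ blockSum (λ u v → ⟦ D u v ⟧) Out.member In.member
  e-∁S-S D = begin
    e D (∁ S) S
      ≡⟨ countPairs-∑ (λ u v → lookup (∁ S) u ∧ lookup S v ∧ D u v) ⟩
    ∑ (allFin n) (λ u → ∑ (allFin n) (λ v → ⟦ lookup (∁ S) u ∧ lookup S v ∧ D u v ⟧))
      ≡⟨ ∑-cong (allFin n) factor ⟩
    ∑ (allFin n) (λ u → ⟦ lookup (∁ S) u ⟧ * ∑ (allFin n) (λ v → ⟦ lookup S v ⟧ * ⟦ D u v ⟧))
      ≡⟨ Out.∑-members _ ⟩
    ∑ (allFin m') (λ i → ∑ (allFin n) (λ v → ⟦ lookup S v ⟧ * ⟦ D (Out.member i) v ⟧))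
      ≡⟨ ∑-cong (allFin m') (λ i → In.∑-members _) ⟩
    blockSum (λ u v → ⟦ D u v ⟧) Out.member In.member ∎
    where
    factor : ∀ u → ∑ (allFin n) (λ v → ⟦ lookup (∁ S) u ∧ lookup S v ∧ D u v ⟧)
                 ≡ ⟦ lookup (∁ S) u ⟧ * ∑ (allFin n) (λ v → ⟦ lookup S v ⟧ * ⟦ D u v ⟧)
    factor u = trans (∑-cong (allFin n) (λ v → trans (⟦∧⟧ (lookup (∁ S) u) _)
                                                     (cong (⟦ lookup (∁ S) u ⟧ *_) (⟦∧⟧ (lookup S v) (D u v)))))
                     (∑-*ˡ (allFin n) ⟦ lookup (∁ S) u ⟧ (λ v → ⟦ lookup S v ⟧ * ⟦ D u v ⟧))

  record Splits (σ : Vec (Fin n) n) (α : Vec (Fin m) m) (β : Vec (Fin m') m') : Set where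
    field
      inside : ∀ i → pos σ (In.member i) ≡ pos α i
      outside : ∀ i → pos σ (Out.member i) ≡ m + pos β i

    inside-< : ∀ i → pos σ (In.member i) < m
    inside-< i = subst (_< m) (sym (inside i)) (Fin.toℕ<n (lookup α i))

    outside-≥ : ∀ i → m ≤ pos σ (Out.member i)
    outside-≥ i = subst (m ≤_) (sym (outside i)) (m≤m+n m (pos β i))

    inside-<-outside : ∀ i j → pos σ (In.member i) < pos σ (Out.member j)
    inside-<-outside i j = <-≤-trans (inside-< i) (outside-≥ j)

  -- Arcs within S or within ∁ S are descents exactly when they are descents of α or β;
  -- every arc from ∁ S to S is a descent, and no arc from S to ∁ S is.
  des-split : ∀ (D : Digraph n) {σ α β} → Splits σ α β →
              des D σ ≡ e D (∁ S) S + (des (induced D S) α + des (delete D S) β)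
  des-split D {σ} {α} {β} σ-splits = begin
    des D σ
      ≡⟨ trans (des-blockSum D σ) (blockSum-split (descent D σ)) ⟩
    (blockSum (descent D σ) In.member In.member + blockSum (descent D σ) In.member Out.member)
      + (blockSum (descent D σ) Out.member In.member + blockSum (descent D σ) Out.member Out.member)
      ≡⟨ cong₂ _+_ (cong₂ _+_ in-in in-out) (cong₂ _+_ out-in out-out) ⟩
    (des (induced D S) α + 0) + (e D (∁ S) S + des (delete D S) β)
      ≡⟨ rearrange (des (induced D S) α) (e D (∁ S) S) (des (delete D S) β) ⟩
    e D (∁ S) S + (des (induced D S) α + des (delete D S) β) ∎
    where
    open Splits σ-splits

    rearrange : ∀ a c b → (a + 0) + (c + b) ≡ c + (a + b)
    rearrange a c b = trans (cong (_+ (c + b)) (+-identityʳ a))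
                            (trans (sym (+-assoc a c b)) (trans (cong (_+ b) (+-comm a c)) (+-assoc c a b)))

    in-in : blockSum (descent D σ) In.member In.member ≡ des (induced D S) α
    in-in = sym (trans (des-blockSum (induced D S) α) (∑-cong (allFin m) λ i → ∑-cong (allFin m) λ j →
              cong (λ b → ⟦ D (In.member i) (In.member j) ∧ b ⟧) (sym (cong₂ _<ᵇ_ (inside j) (inside i)))))

    in-out : blockSum (descent D σ) In.member Out.member ≡ 0
    in-out = ∑-zero (allFin m) λ i → ∑-zero (allFin m') λ j →
               ⟦⟧-false (λ h → <⇒≱ (inside-<-outside i j) (<⇒≤ (<ᵇ⇒< _ _ (proj₂ (T-∧⁻ _ h)))))

    out-in : blockSum (descent D σ) Out.member In.member ≡ e D (∁ S) S
    out-in = sym (trans (e-∁S-S D) (∑-cong (allFin m') λ i → ∑-cong (allFin m) λ j →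
               cong ⟦_⟧ (sym (trans (cong (D (Out.member i) (In.member j) ∧_)
                                          (Equivalence.to T-≡ (<⇒<ᵇ (inside-<-outside j i))))
                                    (∧-identityʳ _)))))

    out-out : blockSum (descent D σ) Out.member Out.member ≡ des (delete D S) β
    out-out = sym (trans (des-blockSum (delete D S) β) (∑-cong (allFin m') λ i → ∑-cong (allFin m') λ j →
                cong (λ b → ⟦ D (Out.member i) (Out.member j) ∧ b ⟧)
                     (sym (trans (cong₂ _<ᵇ_ (outside j) (outside i)) (+-<ᵇ m _ _)))))

  module _ (α : Vec (Fin m) m) (β : Vec (Fin m') m') where

    private
      place : (v : Fin n) → Dec (T (lookup S v)) → Fin n
      place v (yes v∈S) = inject≤ (lookup α (In.rank v v∈S)) m≤n
      place v (no v∉S) = cast m+m'≡n (m ↑ʳ lookup β (Out.rank v (Equivalence.from (∈∁⇔∉ v) v∉S)))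

    glue : Vec (Fin n) n
    glue = tabulate (λ v → place v (T? (lookup S v)))

    glue-splits : Splits glue α β
    glue-splits = record { inside = inside ; outside = outside }
      where
      pos-glue : ∀ v → pos glue v ≡ toℕ (place v (T? (lookup S v)))
      pos-glue v = cong toℕ (Vec.lookup∘tabulate _ v)

      place-in : ∀ i (d : Dec (T (lookup S (In.member i)))) → toℕ (place (In.member i) d) ≡ pos α i
      place-in i (yes i∈S) = trans (Fin.toℕ-inject≤ _ m≤n) (cong (pos α) (In.rank-member i i∈S))
      place-in i (no i∉S) = contradiction (In.member-∈ i) i∉S

      place-out : ∀ i (d : Dec (T (lookup S (Out.member i)))) → toℕ (place (Out.member i) d) ≡ m + pos β i
      place-out i (yes i∈S) = contradiction i∈S (Out-member-∉ i)
      place-out i (no _) = trans (Fin.toℕ-cast m+m'≡n _)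
                                 (trans (Fin.toℕ-↑ʳ m _) (cong (λ j → m + pos β j) (Out.rank-member i _)))

      inside : ∀ i → pos glue (In.member i) ≡ pos α i
      inside i = trans (pos-glue (In.member i)) (place-in i (T? (lookup S (In.member i))))

      outside : ∀ i → pos glue (Out.member i) ≡ m + pos β i
      outside i = trans (pos-glue (Out.member i)) (place-out i (T? (lookup S (Out.member i))))

  lowerPart : Vec (Fin n) n → Vec (Fin m) m
  lowerPart σ = tabulate (λ i → fromℕ-or (pos σ (In.member i)) i)

  upperPart : Vec (Fin n) n → Vec (Fin m') m'
  upperPart σ = tabulate (λ i → fromℕ-or (pos σ (Out.member i) ∸ m) i)

  lowerSet⇒splits : ∀ σ → S ≡ lowerSet m σ → Splits σ (lowerPart σ) (upperPart σ)
  lowerSet⇒splits σ S≡ = record { inside = inside ; outside = outside }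
    where
    ∈⇔lower : ∀ v → T (lookup S v) ⇔ pos σ v < m
    ∈⇔lower v = subst (λ b → T b ⇔ pos σ v < m)
                      (sym (trans (cong (λ X → lookup X v) S≡) (Vec.lookup∘tabulate _ v)))
                      (mk⇔ (<ᵇ⇒< _ _) <⇒<ᵇ)

    inside : ∀ i → pos σ (In.member i) ≡ pos (lowerPart σ) i
    inside i = sym (trans (cong toℕ (Vec.lookup∘tabulate _ i))
                          (toℕ-fromℕ-or _ i (Equivalence.to (∈⇔lower _) (In.member-∈ i))))

    outside : ∀ i → pos σ (Out.member i) ≡ m + pos (upperPart σ) i
    outside i = sym (trans (cong (m +_) (trans (cong toℕ (Vec.lookup∘tabulate _ i)) (toℕ-fromℕ-or _ i below)))
                           (m+[n∸m]≡n above))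
      where
      above : m ≤ pos σ (Out.member i)
      above = ≮⇒≥ (Out-member-∉ i ∘ Equivalence.from (∈⇔lower _))
      below : pos σ (Out.member i) ∸ m < m'
      below = subst (pos σ (Out.member i) ∸ m <_) (trans (cong (_∸ m) (sym m+m'≡n)) (m+n∸m≡n m m'))
                    (∸-monoˡ-< (Fin.toℕ<n (lookup σ (Out.member i))) above)

  module _ {σ α β} (σ-splits : Splits σ α β) where
    open Splits σ-splits

    splits-unique : ∀ {τ} → Splits τ α β → σ ≡ τ
    splits-unique {τ} τ-splits = ≗pos⇒≡ same
      where
      module τ = Splits τ-splits
      same : ∀ v → pos σ v ≡ pos τ v
      same v with member-cases v
      ... | inj₁ (i , refl) = trans (inside i) (sym (τ.inside i))
      ... | inj₂ (i , refl) = trans (outside i) (sym (τ.outside i))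

    splits-lowerSet : lowerSet m σ ≡ S
    splits-lowerSet = tabulate-≡ same
      where
      same : ∀ v → (pos σ v <ᵇ m) ≡ lookup S v
      same v with member-cases v
      ... | inj₁ (i , refl) =
        trans (Equivalence.to T-≡ (<⇒<ᵇ (inside-< i))) (sym (Equivalence.to T-≡ (In.member-∈ i)))
      ... | inj₂ (i , refl) =
        trans (¬T⇒≡false (λ h → <⇒≱ (<ᵇ⇒< _ _ h) (outside-≥ i))) (sym (¬T⇒≡false (Out-member-∉ i)))

    splits-lowerPart : lowerPart σ ≡ α
    splits-lowerPart = tabulate-≡ λ i → Fin.toℕ-injective (trans (toℕ-fromℕ-or _ i (inside-< i)) (inside i))

    splits-upperPart : upperPart σ ≡ β
    splits-upperPart = tabulate-≡ λ i →
      Fin.toℕ-injective (trans (toℕ-fromℕ-or _ i (subst (_< m') (sym (shifted i)) (Fin.toℕ<n _))) (shifted i))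
      where
      shifted : ∀ i → pos σ (Out.member i) ∸ m ≡ pos β i
      shifted i = trans (cong (_∸ m) (outside i)) (m+n∸m≡n m (pos β i))

    splits-injective⁻ : Injective _≡_ _≡_ (lookup σ) →
                        Injective _≡_ _≡_ (lookup α) × Injective _≡_ _≡_ (lookup β)
    splits-injective⁻ σ-inj = α-inj , β-inj
      where
      α-inj : Injective _≡_ _≡_ (lookup α)
      α-inj {i} {j} αi≡αj = In.member-injective (σ-inj (Fin.toℕ-injective
        (trans (inside i) (trans (cong toℕ αi≡αj) (sym (inside j))))))
      β-inj : Injective _≡_ _≡_ (lookup β)
      β-inj {i} {j} βi≡βj = Out.member-injective (σ-inj (Fin.toℕ-injective
        (trans (outside i) (trans (cong (λ x → m + toℕ x) βi≡βj) (sym (outside j))))))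

    splits-injective⁺ : Injective _≡_ _≡_ (lookup α) → Injective _≡_ _≡_ (lookup β) →
                        Injective _≡_ _≡_ (lookup σ)
    splits-injective⁺ α-inj β-inj {u} {v} σu≡σv with member-cases u | member-cases v | cong toℕ σu≡σv
    ... | inj₁ (i , refl) | inj₁ (j , refl) | eq =
      cong In.member (α-inj (Fin.toℕ-injective (trans (sym (inside i)) (trans eq (inside j)))))
    ... | inj₁ (i , refl) | inj₂ (j , refl) | eq = contradiction eq (<⇒≢ (inside-<-outside i j))
    ... | inj₂ (i , refl) | inj₁ (j , refl) | eq = contradiction (sym eq) (<⇒≢ (inside-<-outside j i))
    ... | inj₂ (i , refl) | inj₂ (j , refl) | eq =
      cong Out.member (β-inj (Fin.toℕ-injective (+-cancelˡ-≡ m _ _ (trans (sym (outside i)) (trans eq (outside j))))))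

-- Generating polynomials

gen : {Z : Set} → List Z → (Z → Bool) → (Z → ℕ) → Poly
gen zs p w j = ∑ zs (λ z → ⟦ p z ∧ (w z ≡ᵇ j) ⟧)

A≗gen : ∀ {a} (X : Digraph a) j → A X j ≡ gen (allVecs a a) isBij (des X) j
A≗gen {a} X j = length-filter (T? ∘ λ σ → isBij σ ∧ (des X σ ≡ᵇ j)) (allVecs a a)

⋆-cong : ∀ {f f′ g g′ : Poly} → (∀ i → f i ≡ f′ i) → (∀ i → g i ≡ g′ i) → ∀ j → (f ⋆ g) j ≡ (f′ ⋆ g′) j
⋆-cong f≗f′ g≗g′ j = ∑-cong (upTo (suc j)) (λ i → cong₂ _*_ (f≗f′ i) (g≗g′ (j ∸ i)))

tpow*-cong : ∀ c {f g : Poly} → (∀ i → f i ≡ g i) → ∀ j → (tpow* c) f j ≡ (tpow* c) g j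
tpow*-cong c f≗g j = cong (λ x → if c ≤ᵇ j then x else 0) (f≗g (j ∸ c))

∑-upTo-≡ᵇ : ∀ v w j → ∑ (upTo (suc j)) (λ i → ⟦ v ≡ᵇ i ⟧ * ⟦ w ≡ᵇ j ∸ i ⟧) ≡ ⟦ v + w ≡ᵇ j ⟧
∑-upTo-≡ᵇ zero w j = begin
  ∑ (upTo (suc j)) (λ i → ⟦ 0 ≡ᵇ i ⟧ * ⟦ w ≡ᵇ j ∸ i ⟧)
    ≡⟨ ∑-upTo-suc j (λ i → ⟦ 0 ≡ᵇ i ⟧ * ⟦ w ≡ᵇ j ∸ i ⟧) ⟩
  1 * ⟦ w ≡ᵇ j ⟧ + ∑ (upTo j) (λ _ → 0)
    ≡⟨ cong₂ _+_ (*-identityˡ ⟦ w ≡ᵇ j ⟧) (∑-zero (upTo j) (λ _ → refl)) ⟩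
  ⟦ w ≡ᵇ j ⟧ + 0
    ≡⟨ +-identityʳ _ ⟩
  ⟦ w ≡ᵇ j ⟧ ∎
∑-upTo-≡ᵇ (suc v) w zero = refl
∑-upTo-≡ᵇ (suc v) w (suc j) =
  trans (∑-upTo-suc (suc j) (λ i → ⟦ suc v ≡ᵇ i ⟧ * ⟦ w ≡ᵇ suc j ∸ i ⟧)) (∑-upTo-≡ᵇ v w j)

module _ {X Y : Set} (xs : List X) (ys : List Y) (p : X → Bool) (r : Y → Bool) (v : X → ℕ) (w : Y → ℕ) where

  gen-⋆ : ∀ j → (gen xs p v ⋆ gen ys r w) j
              ≡ gen (xs ⊗ λ _ → ys) (λ (x , y) → p x ∧ r y) (λ (x , y) → v x + w y) j
  gen-⋆ j = begin
    ∑ (upTo (suc j)) (λ i → gen xs p v i * gen ys r w (j ∸ i))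
      ≡⟨ ∑-cong (upTo (suc j)) (λ i → ∑-product xs ys _ _) ⟩
    ∑ (upTo (suc j)) (λ i → ∑ xs (λ x → ∑ ys (λ y → term x y i)))
      ≡⟨ trans (∑-swap (upTo (suc j)) xs _) (∑-cong xs (λ x → ∑-swap (upTo (suc j)) ys _)) ⟩
    ∑ xs (λ x → ∑ ys (λ y → ∑ (upTo (suc j)) (term x y)))
      ≡⟨ ∑-cong xs (λ x → ∑-cong ys (λ y → collapse x y)) ⟩
    ∑ xs (λ x → ∑ ys (λ y → ⟦ (p x ∧ r y) ∧ (v x + w y ≡ᵇ j) ⟧))
      ≡⟨ sym (∑-⊗ xs (λ _ → ys) _) ⟩
    gen (xs ⊗ λ _ → ys) (λ (x , y) → p x ∧ r y) (λ (x , y) → v x + w y) j ∎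
    where
    term : X → Y → ℕ → ℕ
    term x y i = ⟦ p x ∧ (v x ≡ᵇ i) ⟧ * ⟦ r y ∧ (w y ≡ᵇ j ∸ i) ⟧

    collapse : ∀ x y → ∑ (upTo (suc j)) (term x y) ≡ ⟦ (p x ∧ r y) ∧ (v x + w y ≡ᵇ j) ⟧
    collapse x y = begin
      ∑ (upTo (suc j)) (term x y)
        ≡⟨ ∑-cong (upTo (suc j)) (λ i → trans (cong₂ _*_ (⟦∧⟧ (p x) _) (⟦∧⟧ (r y) _))
                                              (*-interchange ⟦ p x ⟧ _ _ _)) ⟩
      ∑ (upTo (suc j)) (λ i → (⟦ p x ⟧ * ⟦ r y ⟧) * (⟦ v x ≡ᵇ i ⟧ * ⟦ w y ≡ᵇ j ∸ i ⟧))
        ≡⟨ ∑-*ˡ (upTo (suc j)) (⟦ p x ⟧ * ⟦ r y ⟧) (λ i → ⟦ v x ≡ᵇ i ⟧ * ⟦ w y ≡ᵇ j ∸ i ⟧) ⟩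
      (⟦ p x ⟧ * ⟦ r y ⟧) * ∑ (upTo (suc j)) (λ i → ⟦ v x ≡ᵇ i ⟧ * ⟦ w y ≡ᵇ j ∸ i ⟧)
        ≡⟨ cong₂ _*_ (sym (⟦∧⟧ (p x) (r y))) (∑-upTo-≡ᵇ (v x) (w y) j) ⟩
      ⟦ p x ∧ r y ⟧ * ⟦ v x + w y ≡ᵇ j ⟧
        ≡⟨ sym (⟦∧⟧ (p x ∧ r y) _) ⟩
      ⟦ (p x ∧ r y) ∧ (v x + w y ≡ᵇ j) ⟧ ∎

≡ᵇ-∸ : ∀ {c j} w → c ≤ j → (w ≡ᵇ j ∸ c) ≡ (c + w ≡ᵇ j)
≡ᵇ-∸ w z≤n = refl
≡ᵇ-∸ w (s≤s c≤j) = ≡ᵇ-∸ w c≤j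

tpow*-gen : ∀ {Z : Set} c (zs : List Z) p w j → (tpow* c) (gen zs p w) j ≡ gen zs p (λ z → c + w z) j
tpow*-gen c zs p w j with c ≤ᵇ j in c≤ᵇj
... | true = ∑-cong zs (λ z → cong (λ b → ⟦ p z ∧ b ⟧)
                                 (≡ᵇ-∸ (w z) (≤ᵇ⇒≤ c j (Equivalence.from T-≡ c≤ᵇj))))
... | false = sym (∑-zero zs (λ z → ⟦⟧-false (λ h → c≰j (subst (c ≤_) (≡ᵇ⇒≡ _ _ (proj₂ (T-∧⁻ (p z) h)))
                                                                    (m≤m+n c (w z))))))
  where
  c≰j : ¬ c ≤ j
  c≰j c≤j = subst T c≤ᵇj (≤⇒≤ᵇ c≤j)

isBijPairWithDes : ∀ {a b} → Digraph a → Digraph b → ℕ → ℕ → Vec (Fin a) a × Vec (Fin b) b → Bool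
isBijPairWithDes X Y c j (α , β) = (isBij α ∧ isBij β) ∧ (c + (des X α + des Y β) ≡ᵇ j)

tpow*-A⋆A : ∀ {a b} (X : Digraph a) (Y : Digraph b) c j →
            (tpow* c) (A X ⋆ A Y) j ≡ ∑ (allVecs a a ⊗ λ _ → allVecs b b) (⟦_⟧ ∘ isBijPairWithDes X Y c j)
tpow*-A⋆A {a} {b} X Y c j = begin
  (tpow* c) (A X ⋆ A Y) j
    ≡⟨ tpow*-cong c (⋆-cong (A≗gen X) (A≗gen Y)) j ⟩
  (tpow* c) (gen (allVecs a a) isBij (des X) ⋆ gen (allVecs b b) isBij (des Y)) j
    ≡⟨ tpow*-cong c (gen-⋆ (allVecs a a) (allVecs b b) isBij isBij (des X) (des Y)) j ⟩
  (tpow* c) (gen pairs (λ (α , β) → isBij α ∧ isBij β) (λ (α , β) → des X α + des Y β)) j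
    ≡⟨ tpow*-gen c pairs (λ (α , β) → isBij α ∧ isBij β) (λ (α , β) → des X α + des Y β) j ⟩
  ∑ pairs (⟦_⟧ ∘ isBijPairWithDes X Y c j) ∎
  where pairs = allVecs a a ⊗ λ _ → allVecs b b

tpow*-A⋆A-comm : ∀ {a b} (X : Digraph a) (Y : Digraph b) c j →
                 (tpow* c) (A X ⋆ A Y) j ≡ (tpow* c) (A Y ⋆ A X) j
tpow*-A⋆A-comm {a} {b} X Y c j = begin
  (tpow* c) (A X ⋆ A Y) j
    ≡⟨ trans (tpow*-A⋆A X Y c j) (∑-⊗ (allVecs a a) (λ _ → allVecs b b) _) ⟩
  ∑ (allVecs a a) (λ α → ∑ (allVecs b b) (λ β → ⟦ isBijPairWithDes X Y c j (α , β) ⟧))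
    ≡⟨ ∑-swap (allVecs a a) (allVecs b b) _ ⟩
  ∑ (allVecs b b) (λ β → ∑ (allVecs a a) (λ α → ⟦ isBijPairWithDes X Y c j (α , β) ⟧))
    ≡⟨ ∑-cong (allVecs b b) (λ β → ∑-cong (allVecs a a) (λ α → cong ⟦_⟧ (symmetric α β))) ⟩
  ∑ (allVecs b b) (λ β → ∑ (allVecs a a) (λ α → ⟦ isBijPairWithDes Y X c j (β , α) ⟧))
    ≡⟨ sym (trans (tpow*-A⋆A Y X c j) (∑-⊗ (allVecs b b) (λ _ → allVecs a a) _)) ⟩
  (tpow* c) (A Y ⋆ A X) j ∎
  where
  symmetric : ∀ α β → isBijPairWithDes X Y c j (α , β) ≡ isBijPairWithDes Y X c j (β , α)
  symmetric α β = cong₂ (λ u d → u ∧ (c + d ≡ᵇ j)) (∧-comm (isBij α) (isBij β)) (+-comm (des X α) (des Y β))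

module Decomposition {n : ℕ} (D : Digraph n) (k j : ℕ) where

  Parts : Subset n → Set
  Parts S = Vec (Fin m) m × Vec (Fin m') m'
    where open Split S

  decompose : Vec (Fin n) n → Σ (Subset n) Parts
  decompose σ = lowerSet k σ , lowerPart σ , upperPart σ
    where open Split (lowerSet k σ)

  compose : Σ (Subset n) Parts → Vec (Fin n) n
  compose (S , α , β) = Split.glue S α β

  isBijWithDes : Vec (Fin n) n → Bool
  isBijWithDes σ = isBij σ ∧ (des D σ ≡ᵇ j)

  isSplitWithDes : Σ (Subset n) Parts → Bool
  isSplitWithDes (S , αβ) = (∣ S ∣ ≡ᵇ k) ∧ isBijPairWithDes (induced D S) (delete D S) (e D (∁ S) S) j αβ

  decompose-onto : k ≤ n → ∀ σ → T (isBijWithDes σ) → T (isSplitWithDes (decompose σ)) × compose (decompose σ) ≡ σ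
  decompose-onto k≤n σ σ-ok = T-∧⁺ (≡⇒≡ᵇ _ _ ∣S∣≡k) (T-∧⁺ (T-∧⁺ α-bij β-bij) des-ok)
                            , sym (splits-unique σ-splits (glue-splits _ _))
    where
    open Split (lowerSet k σ)
    σ-inj = Equivalence.to (isBij⇔injective σ) (proj₁ (T-∧⁻ (isBij σ) σ-ok))
    ∣S∣≡k = ∣lowerSet∣ σ σ-inj k≤n
    σ-splits = lowerSet⇒splits σ (cong (λ x → lowerSet x σ) (sym (trans In.size≡∣S∣ ∣S∣≡k)))
    α-bij = Equivalence.from (isBij⇔injective (lowerPart σ)) (proj₁ (splits-injective⁻ σ-splits σ-inj))
    β-bij = Equivalence.from (isBij⇔injective (upperPart σ)) (proj₂ (splits-injective⁻ σ-splits σ-inj))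
    des-ok = subst (λ d → T (d ≡ᵇ j)) (des-split D σ-splits) (proj₂ (T-∧⁻ (isBij σ) σ-ok))

  compose-onto : ∀ y → T (isSplitWithDes y) → T (isBijWithDes (compose y)) × decompose (compose y) ≡ y
  compose-onto (S , α , β) y-ok = T-∧⁺ (Equivalence.from (isBij⇔injective σ) σ-inj) des-ok
                                , parts-≡ (trans (cong (λ x → lowerSet x σ) (sym m≡k)) (splits-lowerSet σ-splits))
    where
    open Split S
    pair-ok = proj₂ (T-∧⁻ (∣ S ∣ ≡ᵇ k) y-ok)
    bijs-ok = proj₁ (T-∧⁻ (isBij α ∧ isBij β) pair-ok)
    α-bij = proj₁ (T-∧⁻ (isBij α) bijs-ok)
    β-bij = proj₂ (T-∧⁻ (isBij α) bijs-ok)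
    m≡k = trans In.size≡∣S∣ (≡ᵇ⇒≡ _ _ (proj₁ (T-∧⁻ (∣ S ∣ ≡ᵇ k) y-ok)))
    σ = glue α β
    σ-splits = glue-splits α β
    σ-inj = splits-injective⁺ σ-splits (Equivalence.to (isBij⇔injective α) α-bij)
                                       (Equivalence.to (isBij⇔injective β) β-bij)
    des-ok = subst (λ d → T (d ≡ᵇ j)) (sym (des-split D σ-splits)) (proj₂ (T-∧⁻ (isBij α ∧ isBij β) pair-ok))
    parts-≡ : ∀ {S′} → S′ ≡ S → (S′ , Split.lowerPart S′ σ , Split.upperPart S′ σ) ≡ (S , α , β)
    parts-≡ refl = cong₂ (λ α′ β′ → S , α′ , β′) (splits-lowerPart σ-splits) (splits-upperPart σ-splits)

A-expansion : ∀ {n} (D : Digraph n) {k} → k ≤ n → ∀ j →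
  A D j ≡ ∑ (allSubsets n) (λ S → ⟦ ∣ S ∣ ≡ᵇ k ⟧ * (tpow* (e D (∁ S) S)) (A (induced D S) ⋆ A (delete D S)) j)
A-expansion {n} D {k} k≤n j = begin
  A D j
    ≡⟨ trans (length-filter (T? ∘ isBijWithDes) (allVecs n n))
             (∑-cong (allVecs n n) (λ σ → sym (*-identityʳ ⟦ isBijWithDes σ ⟧))) ⟩
  ∑ (allVecs n n) (λ σ → ⟦ isBijWithDes σ ⟧ * 1)
    ≡⟨ ∑-bijection _≟ᵖ_ (allVecs-enumerates n n) parts-enum decompose compose isBijWithDes isSplitWithDes
                   (decompose-onto k≤n) compose-onto (λ _ → 1) ⟩
  ∑ (allSubsets n ⊗ pairs) (λ y → ⟦ isSplitWithDes y ⟧ * 1)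
    ≡⟨ trans (∑-⊗ (allSubsets n) pairs (λ y → ⟦ isSplitWithDes y ⟧ * 1)) (∑-cong (allSubsets n) factor) ⟩
  ∑ (allSubsets n) (λ S → ⟦ ∣ S ∣ ≡ᵇ k ⟧ * (tpow* (e D (∁ S) S)) (A (induced D S) ⋆ A (delete D S)) j) ∎
  where
  open Decomposition D k j

  pairs : (S : Subset n) → List (Parts S)
  pairs S = allVecs _ _ ⊗ λ _ → allVecs _ _

  parts-enum = ⊗-enumerates (allSubsets-enumerates n)
                 (λ _ → ⊗-enumerates (allVecs-enumerates _ _) (λ _ → allVecs-enumerates _ _))
  _≟ᵖ_ = Product.≡-dec (Vec.≡-dec Bool._≟_) (Product.≡-dec (Vec.≡-dec Fin._≟_) (Vec.≡-dec Fin._≟_))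

  weight : (S : Subset n) → Parts S → Bool
  weight S = isBijPairWithDes (induced D S) (delete D S) (e D (∁ S) S) j

  factor : ∀ S → ∑ (pairs S) (λ αβ → ⟦ isSplitWithDes (S , αβ) ⟧ * 1)
               ≡ ⟦ ∣ S ∣ ≡ᵇ k ⟧ * (tpow* (e D (∁ S) S)) (A (induced D S) ⋆ A (delete D S)) j
  factor S = begin
    ∑ (pairs S) (λ αβ → ⟦ isSplitWithDes (S , αβ) ⟧ * 1)
      ≡⟨ ∑-cong (pairs S) (λ αβ → trans (*-identityʳ _) (⟦∧⟧ (∣ S ∣ ≡ᵇ k) (weight S αβ))) ⟩
    ∑ (pairs S) (λ αβ → ⟦ ∣ S ∣ ≡ᵇ k ⟧ * ⟦ weight S αβ ⟧)
      ≡⟨ ∑-*ˡ (pairs S) ⟦ ∣ S ∣ ≡ᵇ k ⟧ (⟦_⟧ ∘ weight S) ⟩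
    ⟦ ∣ S ∣ ≡ᵇ k ⟧ * ∑ (pairs S) (⟦_⟧ ∘ weight S)
      ≡⟨ cong (⟦ ∣ S ∣ ≡ᵇ k ⟧ *_) (sym (tpow*-A⋆A (induced D S) (delete D S) (e D (∁ S) S) j)) ⟩
    ⟦ ∣ S ∣ ≡ᵇ k ⟧ * (tpow* (e D (∁ S) S)) (A (induced D S) ⋆ A (delete D S)) j ∎

complement-expansion : ∀ {n} (D : Digraph n) {k} → k ≤ n → ∀ j →
  A D j ≡ ∑ (allSubsets n) (λ S → ⟦ ∣ S ∣ ≡ᵇ k ⟧ * (tpow* (e D S (∁ S))) (A (induced D S) ⋆ A (delete D S)) j)
complement-expansion {n} D {k} k≤n j = begin
  A D j
    ≡⟨ A-expansion D (m∸n≤m n k) j ⟩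
  ∑ (allSubsets n) term
    ≡⟨ sym (∑-allSubsets-∁ term) ⟩
  ∑ (allSubsets n) (term ∘ ∁)
    ≡⟨ ∑-cong (allSubsets n) (λ S → cong₂ (λ b x → ⟦ b ⟧ * x) (size-∁ S) (swap-sides S)) ⟩
  ∑ (allSubsets n) (λ S → ⟦ ∣ S ∣ ≡ᵇ k ⟧ * (tpow* (e D S (∁ S))) (A (induced D S) ⋆ A (delete D S)) j) ∎
  where
  term : Subset n → ℕ
  term S = ⟦ ∣ S ∣ ≡ᵇ n ∸ k ⟧ * (tpow* (e D (∁ S) S)) (A (induced D S) ⋆ A (delete D S)) j

  size-∁ : ∀ S → (∣ ∁ S ∣ ≡ᵇ n ∸ k) ≡ (∣ S ∣ ≡ᵇ k)
  size-∁ S = T-injective (λ h → ≡⇒≡ᵇ _ _ (∣S∣≡k (≡ᵇ⇒≡ _ _ h)))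
                         (λ h → ≡⇒≡ᵇ _ _ (trans (∣∁p∣≡n∸∣p∣ S) (cong (n ∸_) (≡ᵇ⇒≡ ∣ S ∣ k h))))
    where
    ∣S∣≡k : ∣ ∁ S ∣ ≡ n ∸ k → ∣ S ∣ ≡ k
    ∣S∣≡k eq = trans (sym (m∸[m∸n]≡n (∣p∣≤n S)))
                     (trans (cong (n ∸_) (trans (sym (∣∁p∣≡n∸∣p∣ S)) eq)) (m∸[m∸n]≡n k≤n))

  swap-sides : ∀ S → (tpow* (e D (∁ (∁ S)) (∁ S))) (A (induced D (∁ S)) ⋆ A (induced D (∁ (∁ S)))) j
                   ≡ (tpow* (e D S (∁ S))) (A (induced D S) ⋆ A (delete D S)) j
  swap-sides S =
    trans (cong (λ X → (tpow* (e D X (∁ S))) (A (induced D (∁ S)) ⋆ A (induced D X)) j) (∁-involutive S))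
          (tpow*-A⋆A-comm (delete D S) (induced D S) (e D S (∁ S)) j)

lemma2p2 : (n : ℕ) (D : Digraph n) → (∀ v → D v v ≡ false) →
           (k : ℕ) → 1 ≤ k → k ≤ n →
           ∀ j → 2 * A D j ≡
             sum (map (λ S → (((tpow* (e D S (∁ S))) (A (induced D S) ⋆ A (delete D S)))
                              ⊕ ((tpow* (e D (∁ S) S)) (A (induced D S) ⋆ A (delete D S)))) j)
                      (filter (λ S → ∣ S ∣ ≟ k) (allSubsets n)))
lemma2p2 n D _ k _ k≤n j = begin
  2 * A D j
    ≡⟨ cong (A D j +_) (+-identityʳ (A D j)) ⟩
  A D j + A D j
    ≡⟨ cong₂ _+_ (complement-expansion D k≤n j) (A-expansion D k≤n j) ⟩
  ∑ (allSubsets n) (λ S → ⟦ ∣ S ∣ ≡ᵇ k ⟧ * out S) + ∑ (allSubsets n) (λ S → ⟦ ∣ S ∣ ≡ᵇ k ⟧ * into S)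
    ≡⟨ sym (∑-+ (allSubsets n) _ _) ⟩
  ∑ (allSubsets n) (λ S → ⟦ ∣ S ∣ ≡ᵇ k ⟧ * out S + ⟦ ∣ S ∣ ≡ᵇ k ⟧ * into S)
    ≡⟨ ∑-cong (allSubsets n) (λ S → sym (*-distribˡ-+ ⟦ ∣ S ∣ ≡ᵇ k ⟧ (out S) (into S))) ⟩
  ∑ (allSubsets n) (λ S → ⟦ ∣ S ∣ ≡ᵇ k ⟧ * (out S + into S))
    ≡⟨ sym (∑-filter (λ S → ∣ S ∣ ≟ k) (allSubsets n) (λ S → out S + into S)) ⟩
  ∑ (filter (λ S → ∣ S ∣ ≟ k) (allSubsets n)) (λ S → out S + into S) ∎
  where
  out into : Subset n → ℕ
  out S = (tpow* (e D S (∁ S))) (A (induced D S) ⋆ A (delete D S)) j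
  into S = (tpow* (e D (∁ S) S)) (A (induced D S) ⋆ A (delete D S)) j
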